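{- Let $G$ be a $d$-regular graph with $d\geq 3$. Then $\overset{\rightarrow}{\gamma}_{LD}(G)\leq\alpha'(G)$, where $\alpha'(G)$ is the maximum size of a matching in $G$.
   Context: For an orientation $D$ of a graph $G=(V,E)$ (each edge given exactly one direction), a set $S\subseteq V$ is locating-dominating in $D$ if every $u\notin S$ has an in-neighbour in $S$ and distinct $u,v\notin S$ have distinct sets of in-neighbours in $S$; $\gamma_{LD}(D)$ is the minimum size of such a set. $\overset{\rightarrow}{\gamma}_{LD}(G)$ is the minimum of $\gamma_{LD}(D)$ over all orientations $D$ of $G$. -}

module Defs where

open import Data.Nat using (ℕ; _≤_)
open import Data.Bool using (Bool; true; false; T)
open import Data.Fin using (Fin)
open import Data.Fin.Subset using (Subset; _∈_; _∉_; ∣_∣)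
open import Data.List using (List; length)
open import Data.List.Relation.Unary.AllPairs using (AllPairs)
open import Data.List.Relation.Unary.All using (All)
open import Data.Product using (Σ; _×_; _,_; ∃; ∃-syntax)
open import Data.Sum using (_⊎_)
open import Relation.Nullary using (¬_)
open import Relation.Binary.PropositionalEquality using (_≡_; _≢_)

record Graph (n : ℕ) : Set where
  field
    adj     : Fin n → Fin n → Bool
    sym     : ∀ u v → adj u v ≡ adj v u
    irrefl  : ∀ v → adj v v ≡ false

open Graph public

Edge : ∀ {n} → Graph n → Fin n → Fin n → Set
Edge G u v = T (adj G u v)

nbhd : ∀ {n} → Graph n → Fin n → Subset n
nbhd {n} G v = Data.Vec.tabulate (λ u → adj G v u)
  where import Data.Vec

degree : ∀ {n} → Graph n → Fin n → ℕ
degree G v = ∣ nbhd G v ∣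

Regular : ∀ {n} → ℕ → Graph n → Set
Regular d G = ∀ v → degree G v ≡ d

record Orientation {n} (G : Graph n) : Set where
  field
    arc       : Fin n → Fin n → Bool
    arc⇒edge  : ∀ u v → T (arc u v) → Edge G u v
    oriented  : ∀ u v → Edge G u v → T (arc u v) ⊎ T (arc v u)
    antisym   : ∀ u v → T (arc u v) → ¬ T (arc v u)

open Orientation public

Arc : ∀ {n} {G : Graph n} → Orientation G → Fin n → Fin n → Set
Arc D u v = T (arc D u v)

LocDom : ∀ {n} {G : Graph n} → Orientation G → Subset n → Set
LocDom {n} D S =
  (∀ u → u ∉ S → ∃[ s ] (s ∈ S × Arc D s u)) ×
  (∀ u v → u ∉ S → v ∉ S → u ≢ v →
     ∃[ s ] (s ∈ S × ((Arc D s u × ¬ Arc D s v) ⊎ (Arc D s v × ¬ Arc D s u))))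

Disjoint : ∀ {n} → (Fin n × Fin n) → (Fin n × Fin n) → Set
Disjoint (a , b) (c , d) = a ≢ c × a ≢ d × b ≢ c × b ≢ d

IsMatching : ∀ {n} → Graph n → List (Fin n × Fin n) → Set
IsMatching G M = All (λ { (u , v) → Edge G u v }) M × AllPairs Disjoint M

-- γ_LD(D) ≤ k : some LD set of D has size ≤ k.
-- →γ_LD(G) ≤ α'(G) ⇔ there exist an orientation D, an LD set S of D and a matching M
-- of G with |S| ≤ |M| (since the min over D,S and the max over M are attained).
OrientedLDleMatching : ∀ {n} → Graph n → Set
OrientedLDleMatching {n} G =
  Σ (Orientation G) λ D → Σ (Subset n) λ S → Σ (List (Fin n × Fin n)) λ M →
    LocDom D S × IsMatching G M × ∣ S ∣ ≤ length M

-- Take a matching M with no augmenting path of length 1 or 3; augmenting strictly decreases the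
-- number of unmatched vertices, so such an M exists. From every edge of M choose one endpoint,
-- preferring an endpoint with an unmatched neighbour. The chosen set S has |S| = |M|, and since M has
-- no augmenting path of length 3, every unmatched neighbour of the other endpoint is adjacent to the
-- chosen one as well.
--
-- S is locating-dominating for a suitable orientation as soon as every v ∉ S gets a nonempty set I(v)
-- of S-neighbours, distinct for distinct v: orient s → v exactly when s ∈ I(v). A matched v gets its
-- partner. An unmatched v gets N(v) ∩ S, unless another unmatched vertex has the same S-neighbourhood;
-- then all of N(v) lies in S and v gets N(v) minus one neighbour o(v). Because d ≥ 3 these sets have
-- at least two elements, and because G is regular no neighbourhood is strictly contained in another.
-- The omitted neighbour o(v) is chosen injectively on the unmatched vertices with neighbourhood
-- X = N(v), among the x ∈ X such that no other unmatched vertex is adjacent to all of X ∖ {x}; an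
-- injection into N(t) for some t ∈ X shows that there are enough such x.

module Submission where

open import Defs hiding (sym)
open import Data.Bool using (Bool; true; false; T; not; _∧_)
import Data.Bool as Bool
open import Data.Bool.Properties using (T-∧; T-≡; ⇔→≡; not-involutive)
open import Data.Empty using (⊥)
open import Data.Fin using (Fin; zero; suc; inject≤)
open import Data.Fin.Properties using (_≟_; _<?_; <-cmp; <-asym; any?; all?; injective⇒≤; inject≤-injective)
open import Data.Fin.Subset using (Subset; _∈_; _∉_; _⊆_; _⊂_; ∣_∣)
open import Data.Fin.Subset.Properties using (_∈?_; ⊆-antisym; p⊂q⇒∣p∣<∣q∣)
open import Data.List using (List; []; _∷_; length; lookup; filter; filterᵇ; allFin; _++_; map)
import Data.List as List
open import Data.List.Membership.Propositional using () renaming (_∈_ to _∈ˡ_)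
open import Data.List.Membership.Propositional.Properties
  using (∈-filter⁺; ∈-filter⁻; ∈-allFin; ∈-lookup; ∈-++⁻; ∈-++⁺ˡ; ∈-++⁺ʳ)
open import Data.List.Membership.Setoid.Properties using (index-injective)
open import Data.List.Properties using (length-++; length-map)
open import Data.List.Relation.Unary.All as All using (_∷_)
import Data.List.Relation.Unary.All.Properties as Allₚ
open import Data.List.Relation.Unary.AllPairs using (AllPairs; []; _∷_)
import Data.List.Relation.Unary.AllPairs.Properties as AllPairsₚ
open import Data.List.Relation.Unary.Any using (index; here; there)
open import Data.List.Relation.Unary.Unique.Propositional using (Unique)
import Data.List.Relation.Unary.Unique.Propositional.Properties as Unique
open import Data.Maybe using (Maybe; just; nothing; is-nothing; fromMaybe)
open import Data.Maybe.Properties using (just-injective)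
import Data.Maybe.Properties as Maybe
open import Data.Nat using (ℕ; _≤_; _<_; _+_; s≤s)
open import Data.Nat.Induction using (<-wellFounded)
open import Data.Nat.Properties using (<-irrefl; +-cancelˡ-≤; +-comm; ≤-reflexive; module ≤-Reasoning)
open import Data.Product using (∃; ∃₂; _×_; _,_; proj₁; proj₂)
open import Data.Sum using (_⊎_; inj₁; inj₂)
import Data.Vec as Vec
open import Data.Vec.Properties using (lookup∘tabulate; lookup⇒[]=; []=⇒lookup)
import Data.Vec.Properties as Vec
open import Function using (_∘_; id; _⇔_; mk⇔; Equivalence)
open import Function.Construct.Symmetry using (⇔-sym)
open import Induction.WellFounded using (Acc; acc)
open import Relation.Binary.Definitions using (DecidableEquality; tri<; tri≈; tri>)
open import Relation.Binary.PropositionalEquality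
  using (_≡_; _≢_; refl; sym; trans; cong; subst; setoid; module ≡-Reasoning)
open import Relation.Nullary using (¬_; Dec; yes; no; contradiction)
open import Relation.Nullary.Decidable
  using (T?; isYes; toWitness; fromWitness; decidable-stable; _×-dec_; _⊎-dec_; _→-dec_; ¬?)

module _ {A : Set} where

  lookup-injective : {xs : List A} → Unique xs → ∀ {i j} → lookup xs i ≡ lookup xs j → i ≡ j
  lookup-injective (_ ∷ _)    {zero}  {zero}  _  = refl
  lookup-injective (x∉ ∷ _)   {zero}  {suc j} eq = contradiction eq (All.lookup x∉ (∈-lookup j))
  lookup-injective (x∉ ∷ _)   {suc i} {zero}  eq = contradiction (sym eq) (All.lookup x∉ (∈-lookup i))
  lookup-injective (_ ∷ uxs) {suc i} {suc j} eq = cong suc (lookup-injective uxs eq)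

  length-≤-injection : ∀ {B : Set} {xs : List A} {ys : List B} (f : A → B) → Unique xs →
                       (∀ {x} → x ∈ˡ xs → f x ∈ˡ ys) →
                       (∀ {x y} → x ∈ˡ xs → y ∈ˡ xs → f x ≡ f y → x ≡ y) →
                       length xs ≤ length ys
  length-≤-injection {B} {xs} f uxs into inj = injective⇒≤ image-injective
    where
      image : Fin (length xs) → Fin _
      image i = index (into (∈-lookup i))
      image-injective : ∀ {i j} → image i ≡ image j → i ≡ j
      image-injective {i} {j} eq = lookup-injective uxs
        (inj (∈-lookup i) (∈-lookup j) (index-injective (setoid B) (into (∈-lookup i)) (into (∈-lookup j)) eq))

  AllPairs-from-Unique : ∀ {R : A → A → Set} {xs : List A} → Unique xs →
                        (∀ {x y} → x ∈ˡ xs → y ∈ˡ xs → x ≢ y → R x y) → AllPairs R xs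
  AllPairs-from-Unique []          _ = []
  AllPairs-from-Unique (x∉ ∷ uxs) r =
    All.tabulate (λ y∈ → r (here refl) (there y∈) (All.lookup x∉ y∈)) ∷
    AllPairs-from-Unique uxs (λ x∈ y∈ → r (there x∈) (there y∈))

∣tabulate∣≡length-filterᵇ : ∀ {A : Set} {n} (p : A → Bool) (g : Fin n → A) →
                           ∣ Vec.tabulate (p ∘ g) ∣ ≡ length (filterᵇ p (List.tabulate g))
∣tabulate∣≡length-filterᵇ {n = ℕ.zero}  p g = refl
∣tabulate∣≡length-filterᵇ {n = ℕ.suc n} p g with p (g zero)
... | true  = cong ℕ.suc (∣tabulate∣≡length-filterᵇ p (g ∘ suc))
... | false = ∣tabulate∣≡length-filterᵇ p (g ∘ suc)

module _ {n} {f : Fin n → Bool} {x : Fin n} where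

  ∈-tabulate⁺ : T (f x) → x ∈ Vec.tabulate f
  ∈-tabulate⁺ fx = lookup⇒[]= x _ (trans (lookup∘tabulate f x) (Equivalence.to T-≡ fx))

  ∈-tabulate⁻ : x ∈ Vec.tabulate f → T (f x)
  ∈-tabulate⁻ x∈ = Equivalence.from T-≡ (trans (sym (lookup∘tabulate f x)) ([]=⇒lookup x∈))

module _ {n} {P : Fin n → Set} (P? : ∀ x → Dec (P x)) where

  filter-allFin-unique : Unique (filter P? (allFin n))
  filter-allFin-unique = Unique.filter⁺ P? (Unique.allFin⁺ n)

  ∈-filter-allFin⁺ : ∀ {x} → P x → x ∈ˡ filter P? (allFin n)
  ∈-filter-allFin⁺ {x} = ∈-filter⁺ P? (∈-allFin x)

  ∈-filter-allFin⁻ : ∀ {x} → x ∈ˡ filter P? (allFin n) → P x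
  ∈-filter-allFin⁻ m = proj₂ (∈-filter⁻ P? {xs = allFin n} m)

isYes-<?-flip : ∀ {n} {x y : Fin n} → x ≢ y → isYes (y <? x) ≡ not (isYes (x <? y))
isYes-<?-flip {x = x} {y} x≢y with x <? y | y <? x
... | yes x<y | yes y<x = contradiction y<x (<-asym x<y)
... | yes _   | no _    = refl
... | no _    | yes _   = refl
... | no x≮y  | no y≮x  with <-cmp x y
...   | tri< x<y _ _ = contradiction x<y x≮y
...   | tri≈ _ x≡y _ = contradiction x≡y x≢y
...   | tri> _ _ y<x = contradiction y<x y≮x

distinguish : ∀ {n} {P Q : Fin n → Set} → (∀ x → Dec (P x)) → (∀ x → Dec (Q x)) →
              ¬ (∀ x → P x ⇔ Q x) → ∃ λ x → (P x × ¬ Q x) ⊎ (Q x × ¬ P x)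
distinguish {P = P} {Q} P? Q? ¬same with any? (λ x → (P? x ×-dec ¬? (Q? x)) ⊎-dec (Q? x ×-dec ¬? (P? x)))
... | yes found = found
... | no ¬found = contradiction (λ x → mk⇔ (P⇒Q x) (Q⇒P x)) ¬same
  where
    P⇒Q : ∀ x → P x → Q x
    P⇒Q x p = decidable-stable (Q? x) (λ ¬q → ¬found (x , inj₁ (p , ¬q)))
    Q⇒P : ∀ x → Q x → P x
    Q⇒P x q = decidable-stable (P? x) (λ ¬p → ¬found (x , inj₂ (q , ¬p)))

ThreeDistinct : ∀ {A : Set} → (A → Set) → Set
ThreeDistinct P = ∃ λ x → ∃ λ y → ∃ λ z → x ≢ y × x ≢ z × y ≢ z × P x × P y × P z

TwoDistinct : ∀ {A : Set} → (A → Set) → Set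
TwoDistinct P = ∃₂ λ x y → x ≢ y × P x × P y

module _ {A : Set} where

  no-three-distinct-in-pair : (p q : A) → ¬ ThreeDistinct (λ x → x ≡ p ⊎ x ≡ q)
  no-three-distinct-in-pair p q (_ , _ , _ , x≢y , x≢z , y≢z , x∈ , y∈ , z∈) with x∈ | y∈ | z∈
  ... | inj₁ refl | inj₁ refl | _         = x≢y refl
  ... | inj₂ refl | inj₂ refl | _         = x≢y refl
  ... | inj₁ refl | inj₂ refl | inj₁ refl = x≢z refl
  ... | inj₁ refl | inj₂ refl | inj₂ refl = y≢z refl
  ... | inj₂ refl | inj₁ refl | inj₁ refl = y≢z refl
  ... | inj₂ refl | inj₁ refl | inj₂ refl = x≢z refl

  ¬two-in-singleton : ∀ {P : A → Set} {p} → (∀ x → P x → x ≡ p) → ¬ TwoDistinct P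
  ¬two-in-singleton only (x , y , x≢y , px , py) = x≢y (trans (only x px) (sym (only y py)))

  three⇒two-avoiding : DecidableEquality A → ∀ {P : A → Set} → ThreeDistinct P → ∀ r →
                       TwoDistinct (λ x → P x × x ≢ r)
  three⇒two-avoiding _≟_ (x , y , z , x≢y , x≢z , y≢z , px , py , pz) r with x ≟ r | y ≟ r
  ... | no x≢r   | no y≢r   = x , y , x≢y , (px , x≢r) , (py , y≢r)
  ... | yes refl | _        = y , z , y≢z , (py , x≢y ∘ sym) , (pz , x≢z ∘ sym)
  ... | no x≢r   | yes refl = x , z , x≢z , (px , x≢r) , (pz , y≢z ∘ sym)

module _ {n} (G : Graph n) where

  Edge? : ∀ u v → Dec (Edge G u v)
  Edge? u v = T? (adj G u v)

  Edge-sym : ∀ {u v} → Edge G u v → Edge G v u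
  Edge-sym {u} {v} = subst T (Graph.sym G u v)

  Edge⇒≢ : ∀ {u v} → Edge G u v → u ≢ v
  Edge⇒≢ {u} e refl = subst T (irrefl G u) e

  ∈-nbhd⁺ : ∀ {v u} → Edge G v u → u ∈ nbhd G v
  ∈-nbhd⁺ = ∈-tabulate⁺

  ∈-nbhd⁻ : ∀ {v u} → u ∈ nbhd G v → Edge G v u
  ∈-nbhd⁻ = ∈-tabulate⁻

  neighbours : Fin n → List (Fin n)
  neighbours v = filter (Edge? v) (allFin n)

  length-neighbours : ∀ v → length (neighbours v) ≡ degree G v
  length-neighbours v = sym (∣tabulate∣≡length-filterᵇ (adj G v) id)

  three-neighbours : ∀ {v} → 3 ≤ degree G v → ThreeDistinct (Edge G v)
  three-neighbours {v} 3≤deg =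
    firstThree (neighbours v) (filter-allFin-unique (Edge? v)) (∈-filter-allFin⁻ (Edge? v))
               (subst (3 ≤_) (sym (length-neighbours v)) 3≤deg)
    where
      firstThree : ∀ xs → Unique xs → (∀ {x} → x ∈ˡ xs → Edge G v x) → 3 ≤ length xs →
                   ThreeDistinct (Edge G v)
      firstThree (x ∷ y ∷ z ∷ _) ((x≢y ∷ x≢z ∷ _) ∷ (y≢z ∷ _) ∷ _) edge (s≤s (s≤s (s≤s _))) =
        x , y , z , x≢y , x≢z , y≢z ,
        edge (here refl) , edge (there (here refl)) , edge (there (there (here refl)))

  module _ {d} (regular : Regular d G) where

    length-neighbours≡d : ∀ v → length (neighbours v) ≡ d
    length-neighbours≡d v = trans (length-neighbours v) (regular v)

    nbhd-⊄ : ∀ {u v} → ¬ (nbhd G u ⊂ nbhd G v)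
    nbhd-⊄ {u} {v} u⊂v = <-irrefl (trans (regular u) (sym (regular v))) (p⊂q⇒∣p∣<∣q∣ u⊂v)

    nbhd-⊆⇒≡ : ∀ {u v} → nbhd G u ⊆ nbhd G v → nbhd G u ≡ nbhd G v
    nbhd-⊆⇒≡ {u} {v} u⊆v = ⊆-antisym u⊆v v⊆u
      where
        v⊆u : nbhd G v ⊆ nbhd G u
        v⊆u {x} x∈v with x ∈? nbhd G u
        ... | yes x∈u = x∈u
        ... | no  x∉u = contradiction ((λ {y} → u⊆v {y}) , x , x∈v , x∉u) nbhd-⊄

  orientation : (dir : Fin n → Fin n → Bool) → (∀ {x y} → x ≢ y → dir y x ≡ not (dir x y)) →
                Orientation G
  orientation dir flip = record
    { arc      = λ x y → adj G x y ∧ dir x y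
    ; arc⇒edge = λ _ _ → proj₁ ∘ to T-∧
    ; oriented = orient
    ; antisym  = λ u v uv vu → ¬T∧Tnot (proj₂ (to T-∧ uv))
                                  (subst T (flip (Edge⇒≢ (proj₁ (to T-∧ uv)))) (proj₂ (to T-∧ vu)))
    }
    where
      open Equivalence
      ¬T∧Tnot : ∀ {b} → T b → ¬ T (not b)
      ¬T∧Tnot {true} _ ()
      orient : ∀ u v → Edge G u v → T (adj G u v ∧ dir u v) ⊎ T (adj G v u ∧ dir v u)
      orient u v e with dir u v in eq
      ... | true  = inj₁ (from T-∧ (e , _))
      ... | false = inj₂ (from T-∧ (Edge-sym e , subst T (sym (trans (flip (Edge⇒≢ e)) (cong not eq))) _))

record InNeighbourAssignment {n} (G : Graph n) (S : Subset n) : Set₁ where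
  field
    InNbr     : Fin n → Fin n → Set
    InNbr?    : ∀ v s → Dec (InNbr v s)
    edge      : ∀ {v s} → v ∉ S → InNbr v s → Edge G s v
    inside    : ∀ {v s} → v ∉ S → InNbr v s → s ∈ S
    nonempty  : ∀ {v} → v ∉ S → ∃ (InNbr v)
    injective : ∀ {u v} → u ∉ S → v ∉ S → (∀ s → InNbr u s ⇔ InNbr v s) → u ≡ v

module _ {n} {G : Graph n} {S : Subset n} (A : InNeighbourAssignment G S) where
  open InNeighbourAssignment A

  private
    direction : Fin n → Fin n → Bool
    direction x y with x ∈? S | y ∈? S
    ... | yes _ | no _  = isYes (InNbr? y x)
    ... | no _  | yes _ = not (isYes (InNbr? x y))
    ... | _     | _     = isYes (x <? y)

    direction-flip : ∀ {x y} → x ≢ y → direction y x ≡ not (direction x y)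
    direction-flip {x} {y} x≢y with x ∈? S | y ∈? S
    ... | yes _ | yes _ = isYes-<?-flip x≢y
    ... | yes _ | no _  = refl
    ... | no _  | yes _ = sym (not-involutive _)
    ... | no _  | no _  = isYes-<?-flip x≢y

    direction-leaving-S : ∀ {s v} → s ∈ S → v ∉ S → direction s v ≡ isYes (InNbr? v s)
    direction-leaving-S {s} {v} s∈S v∉S with s ∈? S | v ∈? S
    ... | yes _  | no _    = refl
    ... | no s∉S | _       = contradiction s∈S s∉S
    ... | yes _  | yes v∈S = contradiction v∈S v∉S

  orientationFromInNbrs : Orientation G
  orientationFromInNbrs = orientation G direction direction-flip

  private
    D = orientationFromInNbrs
    open Equivalence

    InNbr⇒Arc : ∀ {v s} → v ∉ S → InNbr v s → Arc D s v
    InNbr⇒Arc v∉S i =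
      from T-∧ (edge v∉S i , subst T (sym (direction-leaving-S (inside v∉S i) v∉S)) (fromWitness i))

    Arc⇒InNbr : ∀ {v s} → s ∈ S → v ∉ S → Arc D s v → InNbr v s
    Arc⇒InNbr s∈S v∉S a = toWitness (subst T (direction-leaving-S s∈S v∉S) (proj₂ (to T-∧ a)))

  locDomFromInNbrs : LocDom orientationFromInNbrs S
  locDomFromInNbrs = dominating , locating
    where
      dominating : ∀ u → u ∉ S → ∃ λ s → s ∈ S × Arc D s u
      dominating u u∉S with nonempty u∉S
      ... | s , i = s , inside u∉S i , InNbr⇒Arc u∉S i
      locating : ∀ u v → u ∉ S → v ∉ S → u ≢ v →
                 ∃ λ s → s ∈ S × ((Arc D s u × ¬ Arc D s v) ⊎ (Arc D s v × ¬ Arc D s u))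
      locating u v u∉S v∉S u≢v with distinguish (InNbr? u) (InNbr? v) (u≢v ∘ injective u∉S v∉S)
      ... | s , inj₁ (iu , ¬iv) =
        s , inside u∉S iu , inj₁ (InNbr⇒Arc u∉S iu , ¬iv ∘ Arc⇒InNbr (inside u∉S iu) v∉S)
      ... | s , inj₂ (iv , ¬iu) =
        s , inside v∉S iv , inj₂ (InNbr⇒Arc v∉S iv , ¬iu ∘ Arc⇒InNbr (inside v∉S iv) u∉S)

module _ {n} (G : Graph n) where

  record Matching : Set where
    field
      mate      : Fin n → Maybe (Fin n)
      mate-sym  : ∀ {x y} → mate x ≡ just y → mate y ≡ just x
      mate-edge : ∀ {x y} → mate x ≡ just y → Edge G x y

  open Matching public

  Unmatched : Matching → Fin n → Set
  Unmatched M x = mate M x ≡ nothing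

  Unmatched? : ∀ M x → Dec (Unmatched M x)
  Unmatched? M x = Maybe.≡-dec _≟_ (mate M x) nothing

  unmatched-≢ : ∀ M {u a b} → Unmatched M u → mate M a ≡ just b → u ≢ a
  unmatched-≢ M u-free a-b refl with trans (sym u-free) a-b
  ... | ()

  unmatched : Matching → Subset n
  unmatched M = Vec.tabulate (is-nothing ∘ mate M)

  module _ (M : Matching) {x : Fin n} where

    ∈-unmatched⁺ : Unmatched M x → x ∈ unmatched M
    ∈-unmatched⁺ x-free = ∈-tabulate⁺ (subst (T ∘ is-nothing) (sym x-free) _)

    ∈-unmatched⁻ : x ∈ unmatched M → Unmatched M x
    ∈-unmatched⁻ x∈ with mate M x | ∈-tabulate⁻ {f = is-nothing ∘ mate M} x∈
    ... | nothing | _ = refl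

  fewer-unmatched : ∀ M M′ {u} → (∀ {x} → Unmatched M′ x → Unmatched M x) →
                    Unmatched M u → ¬ Unmatched M′ u → ∣ unmatched M′ ∣ < ∣ unmatched M ∣
  fewer-unmatched M M′ {u} M′⊆M u-free u-matched =
    p⊂q⇒∣p∣<∣q∣ ( ∈-unmatched⁺ M ∘ M′⊆M ∘ ∈-unmatched⁻ M′
                , u , ∈-unmatched⁺ M u-free , u-matched ∘ ∈-unmatched⁻ M′)

  empty : Matching
  empty = record { mate = λ _ → nothing ; mate-sym = λ () ; mate-edge = λ () }

  module _ (M : Matching) {u v : Fin n} (u-free : Unmatched M u) (v-free : Unmatched M v) (uv : Edge G u v) where

    private
      mate′ : Fin n → Maybe (Fin n)
      mate′ x with x ≟ u | x ≟ v
      ... | yes _ | _     = just v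
      ... | no _  | yes _ = just u
      ... | no _  | no _  = mate M x

      mate′-u : mate′ u ≡ just v
      mate′-u with u ≟ u
      ... | yes _  = refl
      ... | no u≢u = contradiction refl u≢u

      mate′-v : mate′ v ≡ just u
      mate′-v with v ≟ u | v ≟ v
      ... | yes v≡u | _      = contradiction (sym v≡u) (Edge⇒≢ G uv)
      ... | no _    | yes _  = refl
      ... | no _    | no v≢v = contradiction refl v≢v

      mate′-other : ∀ {x} → x ≢ u → x ≢ v → mate′ x ≡ mate M x
      mate′-other {x} x≢u x≢v with x ≟ u | x ≟ v
      ... | yes x≡u | _       = contradiction x≡u x≢u
      ... | no _    | yes x≡v = contradiction x≡v x≢v
      ... | no _    | no _    = refl

    addEdge : Matching
    addEdge = record { mate = mate′ ; mate-sym = mate′-sym ; mate-edge = mate′-edge }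
      where
        mate′-sym : ∀ {x y} → mate′ x ≡ just y → mate′ y ≡ just x
        mate′-sym {x} {y} eq with x ≟ u | x ≟ v
        mate′-sym refl | yes refl | _        = mate′-v
        mate′-sym refl | no _     | yes refl = mate′-u
        mate′-sym {y = y} eq | no _ | no _ = trans (mate′-other y≢u y≢v) (mate-sym M eq)
          where
            y≢u : y ≢ u
            y≢u refl = unmatched-≢ M u-free (mate-sym M eq) refl
            y≢v : y ≢ v
            y≢v refl = unmatched-≢ M v-free (mate-sym M eq) refl
        mate′-edge : ∀ {x y} → mate′ x ≡ just y → Edge G x y
        mate′-edge {x} {y} eq with x ≟ u | x ≟ v
        mate′-edge refl | yes refl | _        = uv
        mate′-edge refl | no _     | yes refl = Edge-sym G uv
        mate′-edge eq   | no _     | no _     = mate-edge M eq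

    addEdge-other : ∀ {x} → x ≢ u → x ≢ v → mate addEdge x ≡ mate M x
    addEdge-other = mate′-other

    addEdge-unmatched : ∀ {x} → Unmatched addEdge x → Unmatched M x × x ≢ u × x ≢ v
    addEdge-unmatched {x} x-free = trans (sym (mate′-other x≢u x≢v)) x-free , x≢u , x≢v
      where
        x≢u : x ≢ u
        x≢u refl with trans (sym x-free) mate′-u
        ... | ()
        x≢v : x ≢ v
        x≢v refl with trans (sym x-free) mate′-v
        ... | ()

  module _ (M : Matching) {a b : Fin n} (ab : mate M a ≡ just b) where

    private
      mate′ : Fin n → Maybe (Fin n)
      mate′ x with x ≟ a | x ≟ b
      ... | no _ | no _ = mate M x
      ... | _    | _    = nothing

      mate′-other : ∀ {x} → x ≢ a → x ≢ b → mate′ x ≡ mate M x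
      mate′-other {x} x≢a x≢b with x ≟ a | x ≟ b
      ... | yes x≡a | _       = contradiction x≡a x≢a
      ... | no _    | yes x≡b = contradiction x≡b x≢b
      ... | no _    | no _    = refl

    removeEdge : Matching
    removeEdge = record { mate = mate′ ; mate-sym = mate′-sym ; mate-edge = mate′-edge }
      where
        mate′-sym : ∀ {x y} → mate′ x ≡ just y → mate′ y ≡ just x
        mate′-sym {x} {y} eq with x ≟ a | x ≟ b
        ... | no x≢a | no x≢b = trans (mate′-other y≢a y≢b) (mate-sym M eq)
          where
            y≢a : y ≢ a
            y≢a refl = x≢b (just-injective (trans (sym (mate-sym M eq)) ab))
            y≢b : y ≢ b
            y≢b refl = x≢a (just-injective (trans (sym (mate-sym M eq)) (mate-sym M ab)))
        mate′-edge : ∀ {x y} → mate′ x ≡ just y → Edge G x y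
        mate′-edge {x} eq with x ≟ a | x ≟ b
        ... | no _ | no _ = mate-edge M eq

    removeEdge-unmatched : ∀ {x} → x ≡ a ⊎ x ≡ b → Unmatched removeEdge x
    removeEdge-unmatched {x} x∈ab with x ≟ a | x ≟ b | x∈ab
    ... | yes _ | _     | _          = refl
    ... | no _  | yes _ | _          = refl
    ... | no x≢a | no _ | inj₁ x≡a   = contradiction x≡a x≢a
    ... | no _  | no x≢b | inj₂ x≡b  = contradiction x≡b x≢b

    removeEdge-other : ∀ {x} → x ≢ a → x ≢ b → mate removeEdge x ≡ mate M x
    removeEdge-other = mate′-other

    removeEdge-unmatched⁻ : ∀ {x} → Unmatched removeEdge x → x ≢ a → x ≢ b → Unmatched M x
    removeEdge-unmatched⁻ x-free x≢a x≢b = trans (sym (mate′-other x≢a x≢b)) x-free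

  Maximal : Matching → Set
  Maximal M = ∀ {u v} → Unmatched M u → Unmatched M v → ¬ Edge G u v

  NoAugmentingPath₃ : Matching → Set
  NoAugmentingPath₃ M = ∀ {a b u u′} → mate M a ≡ just b → Unmatched M u → Unmatched M u′ →
                        Edge G u a → Edge G u′ b → u ≡ u′

  private
    AugmentingPath₁ : Matching → Set
    AugmentingPath₁ M = ∃₂ λ u v → Unmatched M u × Unmatched M v × Edge G u v

    AugmentingPath₃ : Matching → Set
    AugmentingPath₃ M = ∃₂ λ a b → ∃₂ λ u u′ →
      mate M a ≡ just b × Unmatched M u × Unmatched M u′ × u ≢ u′ × Edge G u a × Edge G u′ b

    augmentingPath₁? : ∀ M → Dec (AugmentingPath₁ M)
    augmentingPath₁? M = any? λ u → any? λ v → Unmatched? M u ×-dec Unmatched? M v ×-dec Edge? G u v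

    augmentingPath₃? : ∀ M → Dec (AugmentingPath₃ M)
    augmentingPath₃? M = any? λ a → any? λ b → any? λ u → any? λ u′ →
      Maybe.≡-dec _≟_ (mate M a) (just b) ×-dec Unmatched? M u ×-dec Unmatched? M u′ ×-dec
      ¬? (u ≟ u′) ×-dec Edge? G u a ×-dec Edge? G u′ b

    Smaller : Matching → Set
    Smaller M = ∃ λ M′ → ∣ unmatched M′ ∣ < ∣ unmatched M ∣

    augment₁ : ∀ M → AugmentingPath₁ M → Smaller M
    augment₁ M (u , v , u-free , v-free , uv) =
      M′ , fewer-unmatched M M′ (proj₁ ∘ addEdge-unmatched M u-free v-free uv) u-free
                                (λ u-free′ → proj₁ (proj₂ (addEdge-unmatched M u-free v-free uv u-free′)) refl)
      where M′ = addEdge M u-free v-free uv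

    augment₃ : ∀ M → AugmentingPath₃ M → Smaller M
    augment₃ M (a , b , u , u′ , ab , u-free , u′-free , u≢u′ , ua , u′b) =
      M₃ , fewer-unmatched M M₃ M₃⊆M u-free
             (λ u-free₃ → proj₁ (proj₂ (unmatched₂ (proj₁ (unmatched₃ {u} u-free₃)))) refl)
      where
        ba = mate-sym M ab
        u≢a = unmatched-≢ M u-free ab
        u≢b = unmatched-≢ M u-free ba
        u′≢a = unmatched-≢ M u′-free ab
        u′≢b = unmatched-≢ M u′-free ba
        a≢b = Edge⇒≢ G (mate-edge M ab)
        M₁ = removeEdge M ab
        u-free₁ : Unmatched M₁ u
        u-free₁ = trans (removeEdge-other M ab u≢a u≢b) u-free
        a-free₁ : Unmatched M₁ a
        a-free₁ = removeEdge-unmatched M ab (inj₁ refl)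
        M₂ = addEdge M₁ u-free₁ a-free₁ ua
        unmatched₂ = addEdge-unmatched M₁ u-free₁ a-free₁ ua
        b-free₂ : Unmatched M₂ b
        b-free₂ = trans (addEdge-other M₁ u-free₁ a-free₁ ua (u≢b ∘ sym) (a≢b ∘ sym))
                        (removeEdge-unmatched M ab (inj₂ refl))
        u′-free₂ : Unmatched M₂ u′
        u′-free₂ = trans (addEdge-other M₁ u-free₁ a-free₁ ua (u≢u′ ∘ sym) u′≢a)
                         (trans (removeEdge-other M ab u′≢a u′≢b) u′-free)
        M₃ = addEdge M₂ b-free₂ u′-free₂ (Edge-sym G u′b)
        unmatched₃ = addEdge-unmatched M₂ b-free₂ u′-free₂ (Edge-sym G u′b)
        M₃⊆M : ∀ {x} → Unmatched M₃ x → Unmatched M x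
        M₃⊆M {x} x-free with unmatched₃ {x} x-free
        ... | x-free₂ , x≢b , _ with unmatched₂ {x} x-free₂
        ...   | x-free₁ , _ , x≢a = removeEdge-unmatched⁻ M ab x-free₁ x≢a x≢b

  goodMatching : ∃ λ M → Maximal M × NoAugmentingPath₃ M
  goodMatching = improve empty (<-wellFounded _)
    where
      improve : ∀ M → Acc _<_ ∣ unmatched M ∣ → ∃ λ M → Maximal M × NoAugmentingPath₃ M
      improve M (acc smaller) with augmentingPath₁? M | augmentingPath₃? M
      ... | yes p₁ | _ with augment₁ M p₁
      ...   | M′ , fewer = improve M′ (smaller fewer)
      improve M (acc smaller) | no _ | yes p₃ with augment₃ M p₃
      ...   | M′ , fewer = improve M′ (smaller fewer)
      improve M (acc smaller) | no ¬p₁ | no ¬p₃ =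
        M , (λ u-free v-free uv → ¬p₁ (_ , _ , u-free , v-free , uv)) ,
        λ {_} {_} {u} {u′} ab u-free u′-free ua u′b →
          decidable-stable (u ≟ u′) (λ u≢u′ → ¬p₃ (_ , _ , _ , _ , ab , u-free , u′-free , u≢u′ , ua , u′b))

prefer : Bool → Bool → Bool → Bool
prefer true  false _   = true
prefer false true  _   = false
prefer true  true  tie = tie
prefer false false tie = tie

prefer-flip : ∀ a b tie → prefer b a (not tie) ≡ not (prefer a b tie)
prefer-flip true  true  tie = refl
prefer-flip true  false tie = refl
prefer-flip false true  tie = refl
prefer-flip false false tie = refl

prefer-true : ∀ {a b tie} → T b → T (prefer a b tie) → T a
prefer-true {true}                 _ _  = _
prefer-true {false} {true}         _ ()

module Construction {n} (G : Graph n) {d} (3≤d : 3 ≤ d) (regular : Regular d G)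
                    (M : Matching G) (maximal : Maximal G M) (no-aug₃ : NoAugmentingPath₃ G M) where

  open import Data.List.Membership.DecPropositional (_≟_ {n}) using () renaming (_∈?_ to _∈ˡ?_)

  Free : Fin n → Set
  Free = Unmatched G M

  partner : Fin n → Fin n
  partner x = fromMaybe x (mate M x)

  partner-of : ∀ {x y} → mate M x ≡ just y → partner x ≡ y
  partner-of {x} eq = cong (fromMaybe x) eq

  mate-partner : ∀ {x} → ¬ Free x → mate M x ≡ just (partner x)
  mate-partner {x} x-matched with mate M x
  ... | nothing = contradiction refl x-matched
  ... | just _  = refl

  neighbour-of-free : ∀ {u x} → Free u → Edge G u x → mate M x ≡ just (partner x)
  neighbour-of-free u-free ux = mate-partner (λ x-free → maximal u-free x-free ux)

  hasFreeNeighbour : Fin n → Bool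
  hasFreeNeighbour x = isYes (any? λ u → Unmatched? G M u ×-dec Edge? G x u)

  selected : Fin n → Bool
  selected x with mate M x
  ... | nothing = false
  ... | just y  = prefer (hasFreeNeighbour x) (hasFreeNeighbour y) (isYes (x <? y))

  S : Subset n
  S = Vec.tabulate selected

  selected-pair : ∀ {x y} → mate M x ≡ just y →
                  selected x ≡ prefer (hasFreeNeighbour x) (hasFreeNeighbour y) (isYes (x <? y))
  selected-pair eq rewrite eq = refl

  selected-flip : ∀ {x y} → mate M x ≡ just y → selected y ≡ not (selected x)
  selected-flip {x} {y} xy = begin
    selected y                                      ≡⟨ selected-pair (mate-sym M xy) ⟩
    prefer (hasFreeNeighbour y) (hasFreeNeighbour x) (isYes (y <? x))
      ≡⟨ cong (prefer _ _) (isYes-<?-flip (Edge⇒≢ G (mate-edge M xy))) ⟩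
    prefer (hasFreeNeighbour y) (hasFreeNeighbour x) (not (isYes (x <? y)))
      ≡⟨ prefer-flip (hasFreeNeighbour x) (hasFreeNeighbour y) _ ⟩
    not (prefer (hasFreeNeighbour x) (hasFreeNeighbour y) (isYes (x <? y)))
      ≡⟨ cong not (sym (selected-pair xy)) ⟩
    not (selected x)                                ∎
    where open ≡-Reasoning

  free-∉S : ∀ {x} → Free x → x ∉ S
  free-∉S {x} x-free x∈S with mate M x | ∈-tabulate⁻ {f = selected} x∈S
  ... | nothing | ()

  ∈S⇒mate-partner : ∀ {x} → x ∈ S → mate M x ≡ just (partner x)
  ∈S⇒mate-partner x∈S = mate-partner (λ x-free → free-∉S x-free x∈S)

  mate-∈S⇔∉S : ∀ {x y} → mate M x ≡ just y → y ∈ S ⇔ x ∉ S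
  mate-∈S⇔∉S {x} {y} xy = mk⇔
    (λ y∈S x∈S → T-not⁻ (subst T (selected-flip xy) (∈-tabulate⁻ y∈S)) (∈-tabulate⁻ x∈S))
    (λ x∉S → ∈-tabulate⁺ (subst T (sym (selected-flip xy)) (T-not⁺ (x∉S ∘ ∈-tabulate⁺))))
    where
      T-not⁻ : ∀ {b} → T (not b) → ¬ T b
      T-not⁻ {true} ()
      T-not⁺ : ∀ {b} → ¬ T b → T (not b)
      T-not⁺ {true}  ¬b = ¬b _
      T-not⁺ {false} _  = _

  selected-has-free-neighbour : ∀ {a b u} → mate M a ≡ just b → a ∈ S → Free u → Edge G u b →
                                ∃ λ u′ → Free u′ × Edge G a u′
  selected-has-free-neighbour {a} {b} ab a∈S u-free ub =
    toWitness (prefer-true {hasFreeNeighbour a} {hasFreeNeighbour b}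
                           (fromWitness (_ , u-free , Edge-sym G ub)) (subst T (selected-pair ab) (∈-tabulate⁻ a∈S)))

  selected-covers : ∀ {a b u} → mate M a ≡ just b → a ∈ S → Free u → Edge G u b → Edge G u a
  selected-covers {a} ab a∈S u-free ub with selected-has-free-neighbour ab a∈S u-free ub
  ... | u′ , u′-free , au′ =
    subst (λ w → Edge G w a) (no-aug₃ ab u′-free u-free (Edge-sym G au′) ub) (Edge-sym G au′)

  outside-S-neighbour : ∀ {u x} → Free u → Edge G u x → x ∉ S → partner x ∈ S × Edge G u (partner x)
  outside-S-neighbour u-free ux x∉S =
    p∈S , selected-covers (mate-sym M x-p) p∈S u-free ux
    where
      x-p = neighbour-of-free u-free ux
      p∈S = Equivalence.from (mate-∈S⇔∉S x-p) x∉S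

  S-representative : ∀ {v a} → Free v → Edge G v a →
                     ∃ λ s → (s ∈ S × Edge G v s) × (a ≡ s ⊎ a ≡ partner s)
  S-representative {v} {a} v-free va with a ∈? S
  ... | yes a∈S = a , (a∈S , va) , inj₁ refl
  ... | no  a∉S = partner a , outside-S-neighbour v-free va a∉S ,
                  inj₂ (sym (partner-of (mate-sym M (neighbour-of-free v-free va))))

  three-neighbours-of : ∀ v → ThreeDistinct (Edge G v)
  three-neighbours-of v = three-neighbours G (subst (3 ≤_) (sym (regular v)) 3≤d)

  two-S-neighbours : ∀ {v} → Free v → TwoDistinct (λ s → s ∈ S × Edge G v s)
  two-S-neighbours {v} v-free with three-neighbours-of v
  ... | x , y , z , x≢y , x≢z , y≢z , vx , vy , vz
    with S-representative v-free vx | S-representative v-free vy | S-representative v-free vz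
  ... | s , s-ok , x∈ | t , t-ok , y∈ | r , r-ok , z∈ with s ≟ t | s ≟ r
  ...   | no s≢t    | _         = s , t , s≢t , s-ok , t-ok
  ...   | yes _     | no s≢r    = s , r , s≢r , s-ok , r-ok
  ...   | yes refl  | yes refl  =
    contradiction (x , y , z , x≢y , x≢z , y≢z , x∈ , y∈ , z∈) (no-three-distinct-in-pair s (partner s))

  SameSNeighbours : Fin n → Fin n → Set
  SameSNeighbours u w = ∀ s → s ∈ S → adj G u s ≡ adj G w s

  HasTwin : Fin n → Set
  HasTwin u = ∃ λ w → Free w × w ≢ u × SameSNeighbours u w

  HasTwin? : ∀ u → Dec (HasTwin u)
  HasTwin? u = any? λ w → Unmatched? G M w ×-dec ¬? (w ≟ u) ×-dec
                          all? (λ s → s ∈? S →-dec adj G u s Bool.≟ adj G w s)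

  twin-neighbours-∈S : ∀ {u x} → Free u → HasTwin u → Edge G u x → x ∈ S
  twin-neighbours-∈S {u} {x} u-free (w , w-free , w≢u , same) ux with x ∈? S
  ... | yes x∈S = x∈S
  ... | no  x∉S = contradiction (no-aug₃ (mate-sym M (neighbour-of-free u-free ux)) w-free u-free wp ux) w≢u
    where
      p∈S×up = outside-S-neighbour u-free ux x∉S
      wp : Edge G w (partner x)
      wp = subst T (same (partner x) (proj₁ p∈S×up)) (proj₂ p∈S×up)

  Clone : Subset n → Fin n → Set
  Clone X u = Free u × nbhd G u ≡ X

  -- w could imitate an unmatched vertex with neighbourhood X whose omitted neighbour is x.
  Blocks : Subset n → Fin n → Fin n → Set
  Blocks X x w = Free w × nbhd G w ≢ X × (∀ y → y ∈ X → y ≢ x → Edge G w y)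

  Blocked : Subset n → Fin n → Set
  Blocked X x = ∃ (Blocks X x)

  private
    _≟ˢ_ : (X Y : Subset n) → Dec (X ≡ Y)
    _≟ˢ_ = Vec.≡-dec Bool._≟_

  Clone? : ∀ X u → Dec (Clone X u)
  Clone? X u = Unmatched? G M u ×-dec nbhd G u ≟ˢ X

  Blocked? : ∀ X x → Dec (Blocked X x)
  Blocked? X x = any? λ w → Unmatched? G M w ×-dec ¬? (nbhd G w ≟ˢ X) ×-dec
                            all? (λ y → y ∈? X →-dec ¬? (y ≟ x) →-dec Edge? G w y)

  clones blocked unblocked : Subset n → List (Fin n)
  clones    X = filter (Clone? X) (allFin n)
  blocked   X = filter (λ x → x ∈? X ×-dec Blocked? X x) (allFin n)
  unblocked X = filter (λ x → x ∈? X ×-dec ¬? (Blocked? X x)) (allFin n)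

  some-neighbour : ∀ v → ∃ (Edge G v)
  some-neighbour v with three-neighbours-of v
  ... | x , _ , _ , _ , _ , _ , vx , _ = x , vx

  private
    module Counting {c} (c-free : Free c) where
      N = nbhd G c
      t = proj₁ (some-neighbour c)
      ct = proj₂ (some-neighbour c)
      t-b = neighbour-of-free c-free ct
      b = partner t
      b-matched : ¬ Free b
      b-matched b-free with trans (sym b-free) (mate-sym M t-b)
      ... | ()

      -- Clones are fixed, t goes to its partner and any other blocked x to a vertex blocking it;
      -- every image lies in N(t), which has d = |N| = |blocked N| + |unblocked N| elements.
      image : Fin n → Fin n
      image x with x ≟ t | Unmatched? G M x | Blocked? N x
      ... | yes _ | _     | _           = b
      ... | no _  | yes _ | _           = x
      ... | no _  | no _  | yes (w , _) = w
      ... | no _  | no _  | no _        = x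

      image-t : image t ≡ b
      image-t with t ≟ t
      ... | yes _  = refl
      ... | no t≢t = contradiction refl t≢t

      image-clone : ∀ {x} → Free x → image x ≡ x
      image-clone {x} x-free with x ≟ t | Unmatched? G M x
      ... | yes refl | _           = contradiction x-free (λ t-free → maximal c-free t-free ct)
      ... | no _     | yes _       = refl
      ... | no _     | no x-matched = contradiction x-free x-matched

      image-blocks : ∀ {x} → x ≢ t → ¬ Free x → Blocked N x → Blocks N x (image x)
      image-blocks {x} x≢t x-matched x-blocked with x ≟ t | Unmatched? G M x | Blocked? N x
      ... | yes x≡t | _         | _                = contradiction x≡t x≢t
      ... | no _    | yes x-free | _               = contradiction x-free x-matched
      ... | no _    | no _       | yes (_ , blocks) = blocks
      ... | no _    | no _       | no ¬blocked     = contradiction x-blocked ¬blocked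

      Source : Fin n → Set
      Source x = Clone N x ⊎ (x ∈ N × Blocked N x)

      source : ∀ {x} → x ∈ˡ clones N ++ blocked N → Source x
      source m with ∈-++⁻ (clones N) m
      ... | inj₁ m₁ = inj₁ (∈-filter-allFin⁻ (Clone? N) m₁)
      ... | inj₂ m₂ = inj₂ (∈-filter-allFin⁻ (λ x → x ∈? N ×-dec Blocked? N x) m₂)

      N-matched : ∀ {x} → x ∈ N → ¬ Free x
      N-matched x∈N x-free = maximal c-free x-free (∈-nbhd⁻ G x∈N)

      t∈N : t ∈ N
      t∈N = ∈-nbhd⁺ G ct

      image-of-blocked : ∀ {x} → x ∈ N → Blocked N x →
                         (x ≡ t × image x ≡ b) ⊎ (x ≢ t × Blocks N x (image x))
      image-of-blocked {x} x∈N x-blocked = by-cases (x ≟ t)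
        where
          by-cases : Dec (x ≡ t) → (x ≡ t × image x ≡ b) ⊎ (x ≢ t × Blocks N x (image x))
          by-cases (yes refl) = inj₁ (refl , image-t)
          by-cases (no x≢t)   = inj₂ (x≢t , image-blocks x≢t (N-matched x∈N) x-blocked)

      image-adjacent : ∀ {x} → Source x → Edge G t (image x)
      image-adjacent (inj₁ (x-free , x-N)) =
        subst (Edge G t) (sym (image-clone x-free)) (Edge-sym G (∈-nbhd⁻ G (subst (t ∈_) (sym x-N) t∈N)))
      image-adjacent (inj₂ (x∈N , x-blocked)) with image-of-blocked x∈N x-blocked
      ... | inj₁ (refl , x↦b)           = subst (Edge G t) (sym x↦b) (mate-edge M t-b)
      ... | inj₂ (x≢t , (_ , _ , sees)) = Edge-sym G (sees t t∈N (x≢t ∘ sym))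

      clone-vs-blocked : ∀ {x y} → Clone N x → y ∈ N × Blocked N y → image x ≢ image y
      clone-vs-blocked {x} {y} (x-free , x-N) (y∈N , y-blocked) eq with image-of-blocked y∈N y-blocked
      ... | inj₁ (_ , y↦b)             = b-matched (subst Free (trans (sym (image-clone x-free)) (trans eq y↦b)) x-free)
      ... | inj₂ (_ , (_ , w≢N , _))   = w≢N (subst (λ w → nbhd G w ≡ N) (trans (sym (image-clone x-free)) eq) x-N)

      blocked-vs-blocked : ∀ {x y} → x ∈ N × Blocked N x → y ∈ N × Blocked N y → x ≢ y → image x ≢ image y
      blocked-vs-blocked {x} {y} (x∈N , x-blocked) (y∈N , y-blocked) x≢y eq
        with image-of-blocked x∈N x-blocked | image-of-blocked y∈N y-blocked
      ... | inj₁ (refl , _)    | inj₁ (refl , _)          = x≢y refl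
      ... | inj₁ (_ , x↦b)     | inj₂ (_ , (w-free , _)) = b-matched (subst Free (trans (sym eq) x↦b) w-free)
      ... | inj₂ (_ , (w-free , _)) | inj₁ (_ , y↦b)     = b-matched (subst Free (trans eq y↦b) w-free)
      ... | inj₂ (_ , (_ , w≢N , x-seen)) | inj₂ (_ , y-blocks) = w≢N (sym (nbhd-⊆⇒≡ G regular N⊆w))
        where
          y-seen = proj₂ (proj₂ (subst (Blocks N y) (sym eq) y-blocks))
          N⊆w : N ⊆ nbhd G (image x)
          N⊆w {z} z∈N with z ≟ x
          ... | yes refl = ∈-nbhd⁺ G (y-seen z z∈N x≢y)
          ... | no z≢x   = ∈-nbhd⁺ G (x-seen z z∈N z≢x)

      image-injective : ∀ {x y} → Source x → Source y → x ≢ y → image x ≢ image y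
      image-injective (inj₁ (x-free , _)) (inj₁ (y-free , _)) x≢y eq =
        x≢y (trans (sym (image-clone x-free)) (trans eq (image-clone y-free)))
      image-injective (inj₁ x-clone) (inj₂ y-blocked) _ = clone-vs-blocked x-clone y-blocked
      image-injective (inj₂ x-blocked) (inj₁ y-clone) _ = clone-vs-blocked y-clone x-blocked ∘ sym
      image-injective (inj₂ x-blocked) (inj₂ y-blocked) = blocked-vs-blocked x-blocked y-blocked

      clones++blocked-unique : Unique (clones N ++ blocked N)
      clones++blocked-unique = Unique.++⁺ (filter-allFin-unique _) (filter-allFin-unique _) disjoint
        where
          disjoint : ∀ {x} → x ∈ˡ clones N × x ∈ˡ blocked N → ⊥
          disjoint (m₁ , m₂) =
            N-matched (proj₁ (∈-filter-allFin⁻ _ m₂)) (proj₁ (∈-filter-allFin⁻ (Clone? N) m₁))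

      neighbour-classified : ∀ {x} → x ∈ˡ neighbours G c → x ∈ˡ blocked N ++ unblocked N
      neighbour-classified {x} m with Blocked? N x | ∈-nbhd⁺ G (∈-filter-allFin⁻ (Edge? G c) m)
      ... | yes x-blocked | x∈N = ∈-++⁺ˡ (∈-filter-allFin⁺ _ (x∈N , x-blocked))
      ... | no ¬blocked   | x∈N = ∈-++⁺ʳ (blocked N) (∈-filter-allFin⁺ _ (x∈N , ¬blocked))

      images-in-N[t] : length (clones N ++ blocked N) ≤ length (neighbours G t)
      images-in-N[t] = length-≤-injection image clones++blocked-unique
        (∈-filter-allFin⁺ (Edge? G t) ∘ image-adjacent ∘ source)
        (λ {x} {y} mx my eq → decidable-stable (x ≟ y) (λ x≢y → image-injective (source mx) (source my) x≢y eq))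

      N⊆blocked++unblocked : length (neighbours G c) ≤ length (blocked N ++ unblocked N)
      N⊆blocked++unblocked = length-≤-injection id (filter-allFin-unique (Edge? G c)) neighbour-classified (λ _ _ → id)

      bound : length (clones N) ≤ length (unblocked N)
      bound = +-cancelˡ-≤ (length (blocked N)) _ _ (begin
        length (blocked N) + length (clones N)      ≡⟨ +-comm (length (blocked N)) _ ⟩
        length (clones N) + length (blocked N)      ≡⟨ length-++ (clones N) ⟨
        length (clones N ++ blocked N)              ≤⟨ images-in-N[t] ⟩
        length (neighbours G t)                     ≡⟨ trans (length-neighbours≡d G regular t)
                                                             (sym (length-neighbours≡d G regular c)) ⟩
        length (neighbours G c)                     ≤⟨ N⊆blocked++unblocked ⟩
        length (blocked N ++ unblocked N)           ≡⟨ length-++ (blocked N) ⟩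
        length (blocked N) + length (unblocked N)   ∎)
        where open ≤-Reasoning

  clones≤unblocked : ∀ {X c} → Clone X c → length (clones X) ≤ length (unblocked X)
  clones≤unblocked (c-free , refl) = Counting.bound c-free

  private
    pick : Subset n → Fin n → Fin n
    pick X u with u ∈ˡ? clones X
    ... | yes u∈ = lookup (unblocked X) (inject≤ (index u∈) (clones≤unblocked (∈-filter-allFin⁻ _ u∈)))
    ... | no _   = u

    pick-unblocked : ∀ {X u} → u ∈ˡ clones X → pick X u ∈ˡ unblocked X
    pick-unblocked {X} {u} u∈ with u ∈ˡ? clones X
    ... | yes _  = ∈-lookup _
    ... | no u∉  = contradiction u∈ u∉

    pick-injective : ∀ {X u v} → u ∈ˡ clones X → v ∈ˡ clones X → pick X u ≡ pick X v → u ≡ v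
    pick-injective {X} {u} {v} u∈ v∈ eq with u ∈ˡ? clones X | v ∈ˡ? clones X
    ... | yes mu | yes mv = index-injective (setoid (Fin n)) mu mv
                              (inject≤-injective _ _ _ _ (lookup-injective (filter-allFin-unique _) eq))
    ... | no u∉  | _      = contradiction u∈ u∉
    ... | yes _  | no v∉  = contradiction v∈ v∉

    self-clone : ∀ {u} → Free u → u ∈ˡ clones (nbhd G u)
    self-clone u-free = ∈-filter-allFin⁺ (Clone? _) (u-free , refl)

  omitted : Fin n → Fin n
  omitted u = pick (nbhd G u) u

  omitted-unblocked : ∀ {u} → Free u → Edge G u (omitted u) × ¬ Blocked (nbhd G u) (omitted u)
  omitted-unblocked u-free with ∈-filter-allFin⁻ _ (pick-unblocked (self-clone u-free))
  ... | ∈N , unblocked = ∈-nbhd⁻ G ∈N , unblocked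

  omitted-injective : ∀ {u v} → Free u → Free v → nbhd G u ≡ nbhd G v → omitted u ≡ omitted v → u ≡ v
  omitted-injective {u} {v} u-free v-free N≡ eq =
    pick-injective (self-clone u-free) (∈-filter-allFin⁺ (Clone? _) (v-free , sym N≡))
                   (trans eq (cong (λ X → pick X v) (sym N≡)))

  partner-injective : ∀ {x y} → mate M x ≡ just (partner x) → mate M y ≡ just (partner y) →
                      partner x ≡ partner y → x ≡ y
  partner-injective {x} {y} mx my eq = begin
    x                   ≡⟨ partner-of (mate-sym M mx) ⟨
    partner (partner x) ≡⟨ cong partner eq ⟩
    partner (partner y) ≡⟨ partner-of (mate-sym M my) ⟩
    y                   ∎
    where open ≡-Reasoning

  data Kind (v : Fin n) : Set where
    matched : mate M v ≡ just (partner v) → Kind v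
    twin    : Free v → HasTwin v → Kind v
    loner   : Free v → ¬ HasTwin v → Kind v

  kind : ∀ v → Kind v
  kind v with Unmatched? G M v | HasTwin? v
  ... | no v-matched | _       = matched (mate-partner v-matched)
  ... | yes v-free   | yes tw  = twin v-free tw
  ... | yes v-free   | no ¬tw  = loner v-free ¬tw

  InNbrOf : ∀ {v} → Kind v → Fin n → Set
  InNbrOf {v} (matched _) s = s ≡ partner v
  InNbrOf {v} (twin _ _)  s = Edge G v s × s ≢ omitted v
  InNbrOf {v} (loner _ _) s = s ∈ S × Edge G v s

  InNbrOf? : ∀ {v} (k : Kind v) s → Dec (InNbrOf k s)
  InNbrOf? {v} (matched _) s = s ≟ partner v
  InNbrOf? {v} (twin _ _)  s = Edge? G v s ×-dec ¬? (s ≟ omitted v)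
  InNbrOf? {v} (loner _ _) s = s ∈? S ×-dec Edge? G v s

  InNbrOf-edge : ∀ {v s} (k : Kind v) → InNbrOf k s → Edge G s v
  InNbrOf-edge (matched mv) refl     = Edge-sym G (mate-edge M mv)
  InNbrOf-edge (twin _ _)   (vs , _) = Edge-sym G vs
  InNbrOf-edge (loner _ _)  (_ , vs) = Edge-sym G vs

  InNbrOf-∈S : ∀ {v s} → v ∉ S → (k : Kind v) → InNbrOf k s → s ∈ S
  InNbrOf-∈S v∉S (matched mv)     refl      = Equivalence.from (mate-∈S⇔∉S mv) v∉S
  InNbrOf-∈S _   (twin v-free tw) (vs , _)  = twin-neighbours-∈S v-free tw vs
  InNbrOf-∈S _   (loner _ _)      (s∈S , _) = s∈S

  two-neighbours-but-omitted : ∀ v → TwoDistinct (λ s → Edge G v s × s ≢ omitted v)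
  two-neighbours-but-omitted v = three⇒two-avoiding _≟_ (three-neighbours-of v) (omitted v)

  InNbrOf-nonempty : ∀ {v} (k : Kind v) → ∃ (InNbrOf k)
  InNbrOf-nonempty (matched _) = _ , refl
  InNbrOf-nonempty {v} (twin _ _) with two-neighbours-but-omitted v
  ... | s , _ , _ , i , _ = s , i
  InNbrOf-nonempty (loner v-free _) with two-S-neighbours v-free
  ... | s , _ , _ , i , _ = s , i

  private
    module _ {u v : Fin n} where
      open Equivalence

      loners-separated : Free u → ¬ HasTwin u → Free v →
                         (∀ s → (s ∈ S × Edge G u s) ⇔ (s ∈ S × Edge G v s)) → u ≡ v
      loners-separated u-free ¬tw v-free same =
        decidable-stable (u ≟ v) (λ u≢v → ¬tw (v , v-free , u≢v ∘ sym , same-adj))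
        where
          same-adj : SameSNeighbours u v
          same-adj s s∈S = ⇔→≡ {z = true} (mk⇔
            (λ us → to T-≡ (proj₂ (to (same s) (s∈S , from T-≡ us))))
            (λ vs → to T-≡ (proj₂ (from (same s) (s∈S , from T-≡ vs)))))

      loner-vs-twin : Free u → Free v →
                      (∀ s → (s ∈ S × Edge G u s) ⇔ (Edge G v s × s ≢ omitted v)) → u ≡ v
      loner-vs-twin u-free v-free same =
        decidable-stable (u ≟ v) (λ u≢v → nbhd-⊄ G regular (u⊆v u≢v , omitted v , o∈v , o∉u u≢v))
        where
          nbrs-∈S : u ≢ v → ∀ {x} → Edge G u x → x ∈ S
          nbrs-∈S u≢v {x} ux with x ∈? S
          ... | yes x∈S = x∈S
          ... | no  x∉S with outside-S-neighbour u-free ux x∉S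
          ...   | p∈S , up = contradiction
                    (no-aug₃ (mate-sym M (neighbour-of-free u-free ux)) v-free u-free
                             (proj₁ (to (same _) (p∈S , up))) ux)
                    (u≢v ∘ sym)
          seen : u ≢ v → ∀ {x} → Edge G u x → Edge G v x × x ≢ omitted v
          seen u≢v ux = to (same _) (nbrs-∈S u≢v ux , ux)
          u⊆v : u ≢ v → nbhd G u ⊆ nbhd G v
          u⊆v u≢v = ∈-nbhd⁺ G ∘ proj₁ ∘ seen u≢v ∘ ∈-nbhd⁻ G
          o∈v : omitted v ∈ nbhd G v
          o∈v = ∈-nbhd⁺ G (proj₁ (omitted-unblocked v-free))
          o∉u : u ≢ v → omitted v ∉ nbhd G u
          o∉u u≢v o∈u = proj₂ (seen u≢v (∈-nbhd⁻ G o∈u)) refl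

      twins-separated : Free u → Free v →
                        (∀ s → (Edge G u s × s ≢ omitted u) ⇔ (Edge G v s × s ≢ omitted v)) → u ≡ v
      twins-separated u-free v-free same with nbhd G u ≟ˢ nbhd G v
      ... | no N≢ = contradiction (v , v-free , N≢ ∘ sym , seen) (proj₂ (omitted-unblocked u-free))
        where
          seen : ∀ y → y ∈ nbhd G u → y ≢ omitted u → Edge G v y
          seen y y∈ y≢ = proj₁ (to (same y) (∈-nbhd⁻ G y∈ , y≢))
      ... | yes N≡ with omitted u ≟ omitted v
      ...   | yes o≡ = omitted-injective u-free v-free N≡ o≡
      ...   | no  o≢ = contradiction refl (proj₂ (to (same (omitted v)) (u-o , o≢ ∘ sym)))
        where
          u-o : Edge G u (omitted v)
          u-o = ∈-nbhd⁻ G (subst (omitted v ∈_) (sym N≡) (∈-nbhd⁺ G (proj₁ (omitted-unblocked v-free))))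

  separate : ∀ {u v} (ku : Kind u) (kv : Kind v) → (∀ s → InNbrOf ku s ⇔ InNbrOf kv s) → u ≡ v
  separate (matched mu) (matched mv) same = partner-injective mu mv (Equivalence.to (same _) refl)
  separate (matched _) (twin _ _) same =
    contradiction (two-neighbours-but-omitted _) (¬two-in-singleton (λ s → Equivalence.from (same s)))
  separate (matched _) (loner v-free _) same =
    contradiction (two-S-neighbours v-free) (¬two-in-singleton (λ s → Equivalence.from (same s)))
  separate (twin _ _) (matched _) same =
    contradiction (two-neighbours-but-omitted _) (¬two-in-singleton (λ s → Equivalence.to (same s)))
  separate (loner u-free _) (matched _) same =
    contradiction (two-S-neighbours u-free) (¬two-in-singleton (λ s → Equivalence.to (same s)))
  separate (twin u-free _) (twin v-free _) same = twins-separated u-free v-free same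
  separate (loner u-free ¬tw) (loner v-free _) same = loners-separated u-free ¬tw v-free same
  separate (loner u-free _) (twin v-free _) same = loner-vs-twin u-free v-free same
  separate (twin u-free _) (loner v-free _) same = sym (loner-vs-twin v-free u-free (⇔-sym ∘ same))

  assignment : InNeighbourAssignment G S
  assignment = record
    { InNbr     = λ v → InNbrOf (kind v)
    ; InNbr?    = λ v → InNbrOf? (kind v)
    ; edge      = λ _ → InNbrOf-edge (kind _)
    ; inside    = λ v∉S → InNbrOf-∈S v∉S (kind _)
    ; nonempty  = λ _ → InNbrOf-nonempty (kind _)
    ; injective = λ _ _ → separate (kind _) (kind _)
    }

  private
    selectedList : List (Fin n)
    selectedList = filterᵇ selected (allFin n)

    ∈selectedList⇒∈S : ∀ {x} → x ∈ˡ selectedList → x ∈ S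
    ∈selectedList⇒∈S = ∈-tabulate⁺ ∘ ∈-filter-allFin⁻ (T? ∘ selected)

  matchingEdges : List (Fin n × Fin n)
  matchingEdges = map (λ s → s , partner s) selectedList

  matchingEdges-isMatching : IsMatching G matchingEdges
  matchingEdges-isMatching =
    Allₚ.map⁺ (All.tabulate (mate-edge M ∘ ∈S⇒mate-partner ∘ ∈selectedList⇒∈S)) ,
    AllPairsₚ.map⁺ (AllPairs-from-Unique (filter-allFin-unique _) disjoint)
    where
      disjoint : ∀ {x y} → x ∈ˡ selectedList → y ∈ˡ selectedList → x ≢ y →
                 Disjoint (x , partner x) (y , partner y)
      disjoint mx my x≢y =
        x≢y , (λ { refl → partner-∉S y∈S x∈S }) , (λ { refl → partner-∉S x∈S y∈S }) ,
        x≢y ∘ partner-injective (∈S⇒mate-partner x∈S) (∈S⇒mate-partner y∈S)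
        where
          x∈S = ∈selectedList⇒∈S mx
          y∈S = ∈selectedList⇒∈S my
          partner-∉S : ∀ {z} → z ∈ S → partner z ∉ S
          partner-∉S z∈S p∈S = Equivalence.to (mate-∈S⇔∉S (∈S⇒mate-partner z∈S)) p∈S z∈S

  ∣S∣≡length-matchingEdges : ∣ S ∣ ≡ length matchingEdges
  ∣S∣≡length-matchingEdges = trans (∣tabulate∣≡length-filterᵇ selected id) (sym (length-map _ selectedList))

theorem28 : ∀ {n} (d : ℕ) (G : Graph n) → 3 ≤ d → Regular d G → OrientedLDleMatching G
theorem28 d G 3≤d regular with goodMatching G
... | M , maximal , no-aug₃ =
  orientationFromInNbrs assignment , S , matchingEdges , locDomFromInNbrs assignment ,
  matchingEdges-isMatching , ≤-reflexive ∣S∣≡length-matchingEdges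
  where open Construction G 3≤d regular M maximal no-aug₃
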